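{- For sCCS-PDL processes $P$ and $Q$ and a proposition symbol $p$: $\overrightarrow{{\cal R}_f}(P) = \overrightarrow{{\cal R}_f}(Q)$ if and only if $\Vdash \langle P \rangle p \leftrightarrow \langle Q \rangle p$.
   Context: sCCS-PDL formulas: $\varphi ::= p \mid \top \mid \neg \varphi \mid \varphi_1 \land \varphi_2 \mid \langle P \rangle \varphi$, with processes $P ::= \alpha \mid \alpha.P \mid P_1 + P_2 \mid P_1|P_2$, $\alpha \in {\cal N} \cup \overline{\cal N} \cup \{\tau\}$ (CCS without constants or restriction). $\overrightarrow{{\cal R}_f}(P) = \{\overrightarrow{\alpha} : P \stackrel{\overrightarrow{\alpha}}{\Rightarrow} \mathrm{Done}\}$ is the set of finite action sequences after which $P$ may successfully terminate under the CCS transition rules ($\mathrm{Done}$ = successful termination). A frame is $(W,\{R_\alpha\})$ with a binary relation per action; a model adds a valuation ${\bf V}$. Satisfaction is standard for Boolean connectives, and ${\cal M},w \Vdash \langle P \rangle \varphi$ iff there is a finite path $(v_0,\ldots,v_n)$, $n \geq 1$, with $v_0 = w$, ${\cal M},v_n \Vdash \varphi$, and some $\overrightarrow{\alpha} \in \overrightarrow{{\cal R}_f}(P)$ of length $n$ such that $(v_{i-1},v_i) \in R_\beta$ iff $(\overrightarrow{\alpha})_i = \beta$ for $1 \leq i \leq n$. $\Vdash \varphi$ means $\varphi$ holds at every state of every model. -}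

module Defs where

open import Data.Nat using (ℕ; _≥_)
open import Data.List using (List; []; _∷_; length)
open import Data.Product using (Σ; ∃; _×_; _,_)
open import Relation.Binary.PropositionalEquality using (_≡_)
open import Relation.Nullary using (¬_)
open import Function.Bundles using (_⇔_)

Name : Set
Name = ℕ

data Act : Set where
  nm  : Name → Act
  co  : Name → Act
  τ   : Act

data Compl : Act → Act → Set where
  nm-co : ∀ a → Compl (nm a) (co a)
  co-nm : ∀ a → Compl (co a) (nm a)

infixr 30 _∙_
infixl 20 _⊕_
infixl 25 _∥_

data Proc : Set where
  act : Act → Proc
  _∙_ : Act → Proc → Proc
  _⊕_ : Proc → Proc → Proc
  _∥_ : Proc → Proc → Proc

-- Residual states: a process or successful termination Done
data State : Set where
  proc : Proc → State
  Done : State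

_∥ₛ_ : State → State → State
Done   ∥ₛ Y      = Y
proc P ∥ₛ Done   = proc P
proc P ∥ₛ proc Q = proc (P ∥ Q)

data _─[_]→_ : Proc → Act → State → Set where
  t-act  : ∀ {α} → act α ─[ α ]→ Done
  t-pre  : ∀ {α P} → (α ∙ P) ─[ α ]→ proc P
  t-sumˡ : ∀ {P Q α X} → P ─[ α ]→ X → (P ⊕ Q) ─[ α ]→ X
  t-sumʳ : ∀ {P Q α X} → Q ─[ α ]→ X → (P ⊕ Q) ─[ α ]→ X
  t-parˡ : ∀ {P Q α X} → P ─[ α ]→ X → (P ∥ Q) ─[ α ]→ (X ∥ₛ proc Q)
  t-parʳ : ∀ {P Q α Y} → Q ─[ α ]→ Y → (P ∥ Q) ─[ α ]→ (proc P ∥ₛ Y)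
  t-com  : ∀ {P Q α β X Y} → Compl α β → P ─[ α ]→ X → Q ─[ β ]→ Y →
           (P ∥ Q) ─[ τ ]→ (X ∥ₛ Y)

-- multi-step transitions  X ⇒[α⃗] Y  (τ steps are recorded in the sequence)
data _⇒[_]_ : State → List Act → State → Set where
  ⇒-refl : ∀ {X} → X ⇒[ [] ] X
  ⇒-step : ∀ {P α X αs Y} → P ─[ α ]→ X → X ⇒[ αs ] Y → proc P ⇒[ α ∷ αs ] Y

Rf : Proc → List Act → Set
Rf P αs = proc P ⇒[ αs ] Done

PropSym : Set
PropSym = ℕ

infixr 6 _∧ᶠ_

data Form : Set where
  var  : PropSym → Form
  ⊤ᶠ   : Form
  ¬ᶠ_  : Form → Form
  _∧ᶠ_ : Form → Form → Form
  ⟨_⟩_ : Proc → Form → Form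

_→ᶠ_ : Form → Form → Form
φ →ᶠ ψ = ¬ᶠ (φ ∧ᶠ ¬ᶠ ψ)

_↔ᶠ_ : Form → Form → Form
φ ↔ᶠ ψ = (φ →ᶠ ψ) ∧ᶠ (ψ →ᶠ φ)

record Model : Set₁ where
  field
    W : Set
    R : Act → W → W → Set
    V : PropSym → W → Set

open Model public

data Path (M : Model) : W M → List Act → W M → Set where
  p-nil  : ∀ {w} → Path M w [] w
  p-cons : ∀ {w u v α αs} → (∀ β → R M β w u ⇔ (α ≡ β)) →
           Path M u αs v → Path M w (α ∷ αs) v

_⊩_∶_ : (M : Model) → W M → Form → Set
M ⊩ w ∶ var p    = V M p w
M ⊩ w ∶ ⊤ᶠ       = Data.Unit.⊤ where import Data.Unit
M ⊩ w ∶ (¬ᶠ φ)   = ¬ (M ⊩ w ∶ φ)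
M ⊩ w ∶ (φ ∧ᶠ ψ) = (M ⊩ w ∶ φ) × (M ⊩ w ∶ ψ)
M ⊩ w ∶ (⟨ P ⟩ φ) =
  Σ (List Act) λ αs → Rf P αs × length αs ≥ 1 ×
    Σ (W M) λ v → Path M w αs v × (M ⊩ v ∶ φ)

⊩_ : Form → Set₁
⊩ φ = ∀ (M : Model) (w : W M) → M ⊩ w ∶ φ

_≐_ : (List Act → Set) → (List Act → Set) → Set
A ≐ B = ∀ αs → A αs ⇔ B αs

-- Soundness is immediate, since ⟨P⟩φ only inspects the traces in R_f(P). For the
-- converse, evaluate the formula in the trace model, whose states are action
-- sequences, each one stepping to its tail, with p true exactly at []: there
-- ⟨P⟩p holds at α⃗ iff α⃗ ∈ R_f(P). The valid implication ⟨P⟩p → ⟨Q⟩p then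
-- yields ¬¬ (α⃗ ∈ R_f(Q)) from α⃗ ∈ R_f(P), and membership in R_f(Q) is decidable
-- because a process has only finitely many transitions.
module Submission where

open import Defs
open import Function using (_∘_)
open import Function.Bundles using (_⇔_; mk⇔; Equivalence)
open import Data.Nat using (_≟_; s≤s; z≤n; _≥_)
open import Data.List using (List; []; _∷_; _++_; length)
open import Data.List.Properties using (++-identityʳ; ∷-injectiveˡ)
open import Data.Product using (Σ; _×_; _,_; proj₁; proj₂)
open import Data.Sum using (_⊎_; inj₁; inj₂)
open import Relation.Nullary using (Dec; yes; no)
open import Relation.Nullary.Decidable using (map′; _×-dec_; _⊎-dec_; decidable-stable)
open import Relation.Binary.Definitions using (Decidable; DecidableEquality)
open import Relation.Binary.PropositionalEquality using (_≡_; refl; sym; trans; cong; subst)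

_≟ₐ_ : DecidableEquality Act
nm a ≟ₐ nm b = map′ (cong nm) (λ { refl → refl }) (a ≟ b)
co a ≟ₐ co b = map′ (cong co) (λ { refl → refl }) (a ≟ b)
τ    ≟ₐ τ    = yes refl
nm _ ≟ₐ co _ = no λ ()
nm _ ≟ₐ τ    = no λ ()
co _ ≟ₐ nm _ = no λ ()
co _ ≟ₐ τ    = no λ ()
τ    ≟ₐ nm _ = no λ ()
τ    ≟ₐ co _ = no λ ()

compl? : Decidable Compl
compl? (nm a) (co b) = map′ (λ { refl → nm-co a }) (λ { (nm-co _) → refl }) (a ≟ b)
compl? (co a) (nm b) = map′ (λ { refl → co-nm a }) (λ { (co-nm _) → refl }) (a ≟ b)
compl? (nm _) (nm _) = no λ ()
compl? (nm _) τ      = no λ ()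
compl? (co _) (co _) = no λ ()
compl? (co _) τ      = no λ ()
compl? τ      _      = no λ ()

StepInto : Proc → (Act → State → Set) → Set
StepInto P D = Σ Act λ α → Σ State λ X → P ─[ α ]→ X × D α X

stepInto? : (P : Proc) (D : Act → State → Set) → Decidable D → Dec (StepInto P D)
stepInto? (act β) D D? =
  map′ (λ x → β , Done , t-act , x) (λ { (_ , _ , t-act , x) → x }) (D? β Done)
stepInto? (β ∙ P) D D? =
  map′ (λ x → β , proc P , t-pre , x) (λ { (_ , _ , t-pre , x) → x }) (D? β (proc P))
stepInto? (P ⊕ Q) D D? = map′ sum⇒ ⇒sum (stepInto? P D D? ⊎-dec stepInto? Q D D?)
  where
  sum⇒ : StepInto P D ⊎ StepInto Q D → StepInto (P ⊕ Q) D
  sum⇒ (inj₁ (α , X , t , x)) = α , X , t-sumˡ t , x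
  sum⇒ (inj₂ (α , X , t , x)) = α , X , t-sumʳ t , x
  ⇒sum : StepInto (P ⊕ Q) D → StepInto P D ⊎ StepInto Q D
  ⇒sum (α , X , t-sumˡ t , x) = inj₁ (α , X , t , x)
  ⇒sum (α , X , t-sumʳ t , x) = inj₂ (α , X , t , x)
stepInto? (P ∥ Q) D D? = map′ sum⇒ ⇒sum (left? ⊎-dec right? ⊎-dec com?)
  where
  Left  = StepInto P (λ α X → D α (X ∥ₛ proc Q))
  Right = StepInto Q (λ α Y → D α (proc P ∥ₛ Y))
  Com   = StepInto P (λ α X → StepInto Q (λ β Y → Compl α β × D τ (X ∥ₛ Y)))
  left? : Dec Left
  left? = stepInto? P _ (λ α X → D? α (X ∥ₛ proc Q))
  right? : Dec Right
  right? = stepInto? Q _ (λ α Y → D? α (proc P ∥ₛ Y))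
  com? : Dec Com
  com? = stepInto? P _ λ α X → stepInto? Q _ λ β Y → compl? α β ×-dec D? τ (X ∥ₛ Y)
  sum⇒ : Left ⊎ Right ⊎ Com → StepInto (P ∥ Q) D
  sum⇒ (inj₁ (α , X , t , x))                      = α , _ , t-parˡ t , x
  sum⇒ (inj₂ (inj₁ (α , Y , u , x)))               = α , _ , t-parʳ u , x
  sum⇒ (inj₂ (inj₂ (_ , _ , t , _ , _ , u , c , x))) = τ , _ , t-com c t u , x
  ⇒sum : StepInto (P ∥ Q) D → Left ⊎ Right ⊎ Com
  ⇒sum (α , _ , t-parˡ t , x)     = inj₁ (α , _ , t , x)
  ⇒sum (α , _ , t-parʳ u , x)     = inj₂ (inj₁ (α , _ , u , x))
  ⇒sum (_ , _ , t-com c t u , x) = inj₂ (inj₂ (_ , _ , t , _ , _ , u , c , x))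

⇒Done? : (X : State) (αs : List Act) → Dec (X ⇒[ αs ] Done)
⇒Done? Done     []       = yes ⇒-refl
⇒Done? Done     (_ ∷ _)  = no λ ()
⇒Done? (proc P) []       = no λ ()
⇒Done? (proc P) (α ∷ αs) =
  map′ (λ { (_ , _ , t , refl , r) → ⇒-step t r }) (λ { (⇒-step t r) → _ , _ , t , refl , r })
       (stepInto? P (λ β X → β ≡ α × X ⇒[ αs ] Done) (λ β X → (β ≟ₐ α) ×-dec ⇒Done? X αs))

Rf? : (P : Proc) (αs : List Act) → Dec (Rf P αs)
Rf? P = ⇒Done? (proc P)

Rf-nonempty : ∀ {P αs} → Rf P αs → length αs ≥ 1
Rf-nonempty (⇒-step _ _) = s≤s z≤n

⟨⟩-mono : ∀ {P Q} → (∀ αs → Rf P αs → Rf Q αs) →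
          ∀ M w φ → M ⊩ w ∶ (⟨ P ⟩ φ) → M ⊩ w ∶ (⟨ Q ⟩ φ)
⟨⟩-mono P⊆Q M w φ (αs , r , len , v , path , v⊩φ) = αs , P⊆Q αs r , len , v , path , v⊩φ

traceModel : Model
traceModel = record
  { W = List Act
  ; R = λ β w u → w ≡ β ∷ u
  ; V = λ _ w → w ≡ []
  }

trace-path : (αs : List Act) → Path traceModel αs αs []
trace-path []       = p-nil
trace-path (α ∷ αs) = p-cons (λ β → mk⇔ ∷-injectiveˡ (λ { refl → refl })) (trace-path αs)

path⇒++ : ∀ {w βs v} → Path traceModel w βs v → w ≡ βs ++ v
path⇒++ {βs = α ∷ _} (p-cons edge path) =
  trans (Equivalence.from (edge α) refl) (cong (α ∷_) (path⇒++ path))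
path⇒++ p-nil = refl

trace-⟨⟩ : ∀ P p αs → traceModel ⊩ αs ∶ (⟨ P ⟩ var p) ⇔ Rf P αs
trace-⟨⟩ P p αs = mk⇔
  (λ { (βs , r , _ , _ , path , refl) →
         subst (Rf P) (sym (trans (path⇒++ path) (++-identityʳ βs))) r })
  (λ r → αs , r , Rf-nonempty r , [] , trace-path αs , refl)

valid-→ᶠ⇒⊆ : ∀ P Q p → ⊩ ((⟨ P ⟩ var p) →ᶠ (⟨ Q ⟩ var p)) → ∀ αs → Rf P αs → Rf Q αs
valid-→ᶠ⇒⊆ P Q p valid αs r = decidable-stable (Rf? Q αs) λ ¬q →
  valid traceModel αs (Equivalence.from (trace-⟨⟩ P p αs) r , ¬q ∘ Equivalence.to (trace-⟨⟩ Q p αs))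

theorem3p5 : (P Q : Proc) (p : PropSym) →
    (Rf P ≐ Rf Q) ⇔ (⊩ ((⟨ P ⟩ var p) ↔ᶠ (⟨ Q ⟩ var p)))
theorem3p5 P Q p = mk⇔ sound complete
  where
  sound : Rf P ≐ Rf Q → ⊩ ((⟨ P ⟩ var p) ↔ᶠ (⟨ Q ⟩ var p))
  sound P≐Q M w =
    (λ (P⊩ , ¬Q⊩) → ¬Q⊩ (⟨⟩-mono (λ αs → Equivalence.to (P≐Q αs)) M w (var p) P⊩)) ,
    (λ (Q⊩ , ¬P⊩) → ¬P⊩ (⟨⟩-mono (λ αs → Equivalence.from (P≐Q αs)) M w (var p) Q⊩))
  complete : ⊩ ((⟨ P ⟩ var p) ↔ᶠ (⟨ Q ⟩ var p)) → Rf P ≐ Rf Q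
  complete valid αs = mk⇔
    (valid-→ᶠ⇒⊆ P Q p (λ M w → proj₁ (valid M w)) αs)
    (valid-→ᶠ⇒⊆ Q P p (λ M w → proj₂ (valid M w)) αs)
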